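{- For every $w\in\mathfrak{S}_n$ we have $|P^w_{\ell(w)-1}|\ge |P^w_1|$, and if $w$ contains the pattern $4231$ then $|P^w_{\ell(w)-1}|>|P^w_1|$.
   Context: $\ell(w)$ is the number of inversions of $w\in\mathfrak{S}_n$; Bruhat order on $\mathfrak{S}_n$ is the transitive closure of $w<wt$ for transpositions $t$ with $\ell(wt)>\ell(w)$, and $P^w_k=\{u\le w \text{ in Bruhat order}:\ell(u)=k\}$. $w$ contains $\pi\in\mathfrak{S}_m$ if there are indices $i_1<\dots<i_m$ such that $w(i_1),\dots,w(i_m)$ are in the same relative order as $\pi(1),\dots,\pi(m)$. -}

module Defs where

open import Data.Nat as ℕ using (ℕ; _+_; _≤_; _<_)
open import Data.Fin as F using (Fin; zero; suc)
open import Data.Fin.Properties using (_<?_)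
open import Data.Vec using (Vec; lookup; tabulate; toList; _∷_; [])
open import Data.List using (List; map; length; allFin)
open import Data.Nat.ListAction using (sum)
open import Data.List.Relation.Unary.Unique.Propositional using (Unique)
open import Data.List.Membership.Propositional using (_∈_)
open import Data.Fin.Permutation.Components using (transpose)
open import Data.Product using (Σ; ∃; _×_)
open import Function.Bundles using (_⇔_)
open import Relation.Nullary using (¬_; does)
open import Relation.Binary.PropositionalEquality using (_≡_; _≢_)
open import Data.Bool using (_∧_; if_then_else_)

-- A permutation of {0,…,n-1} in one-line notation: w(i) = lookup w i.
Word : ℕ → Set
Word n = Vec (Fin n) n

IsPerm : ∀ {n} → Word n → Set
IsPerm w = Unique (toList w)

inv : ∀ {n} → Word n → ℕ
inv {n} w = sum (map (λ i → sum (map (λ j →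
  if does (i <? j) ∧ does (lookup w j <? lookup w i) then 1 else 0)
  (allFin n))) (allFin n))

_·t[_,_] : ∀ {n} → Word n → Fin n → Fin n → Word n
w ·t[ i , j ] = tabulate (λ k → lookup w (transpose i j k))

data _≤B_ {n : ℕ} (u : Word n) : Word n → Set where
  ≤B-refl : u ≤B u
  ≤B-step : ∀ {v} (i j : Fin n) → i ≢ j → inv v < inv (v ·t[ i , j ]) →
            u ≤B v → u ≤B (v ·t[ i , j ])

P : ∀ {n} → Word n → ℕ → Word n → Set
P w k u = IsPerm u × u ≤B w × inv u ≡ k

HasSize : ∀ {n} → (Word n → Set) → ℕ → Set
HasSize {n} Q m = Σ (List (Word n)) λ xs →
  Unique xs × (∀ u → (u ∈ xs) ⇔ Q u) × length xs ≡ m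

Contains : ∀ {n m} → Word n → Word m → Set
Contains {n} {m} w π = Σ (Fin m → Fin n) λ f →
  (∀ a b → a F.< b → f a F.< f b) ×
  (∀ a b → (lookup w (f a) F.< lookup w (f b)) ⇔ (lookup π a F.< lookup π b))

-- The pattern 4231 in 0-based one-line notation.
p4231 : Word 4
p4231 = F.fromℕ 3 ∷ suc zero ∷ suc (suc zero) ∷ zero ∷ []

module Submission where

-- The atoms below w are the simple transpositions s_p for which w has an inversion (c , k) across
-- the cut, c ≤ p < k.  To such a cut assign the inversion (a , k) of w where k is the first position
-- after p whose value lies below some value at or before p, and a is the last position at or before p
-- whose value exceeds w(k).  No position between a and k carries a value between w(k) and w(a), so
-- ℓ(w·(a k)) = ℓ(w) − 1, and distinct cuts give distinct coatoms.  If w contains 4231 at p < q < r < s,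
-- some coatom w·(x s′) with p ≤ x < r < s′ and w(s′) < w(r) is assigned to no cut.

open import Defs
open import Data.Nat as ℕ using (ℕ; zero; suc; _+_; _*_; _∸_; _≤_; _<_; z≤n; s≤s)
import Data.Nat.Properties as ℕₚ
open import Data.Nat.Tactic.RingSolver using (solve-∀)
import Data.Nat.ListAction as ListAction
open import Data.Fin as F using (Fin; zero; suc; toℕ)
open import Data.Fin.Patterns using (0F; 1F; 2F; 3F)
open import Data.Fin.Properties as Fₚ using (_<?_; punchInᵢ≢i)
open import Data.Fin.Permutation.Components using (transpose; transpose-inverse)
open import Data.Vec as Vec using (Vec; lookup; tabulate; toList)
import Data.Vec.Properties as Vecₚ
open Vecₚ using (lookup∘tabulate; tabulate-cong; tabulate∘lookup)
import Data.List as List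
open import Data.List using (List; []; _∷_; length)
open import Data.List.Membership.Propositional using (_∈_)
import Data.List.Membership.Propositional.Properties as ∈ₚ
open import Data.List.Relation.Unary.Any using (here; there)
import Data.List.Relation.Unary.All as All
open import Data.List.Relation.Unary.AllPairs using (_∷_)
import Data.List.Properties as Listₚ
import Data.List.Relation.Unary.All.Properties as Allₚ
open import Data.List.Relation.Unary.Unique.Propositional using (Unique)
import Data.List.Relation.Unary.Unique.Propositional.Properties as Uniqueₚ
import Data.List.Relation.Unary.Unique.DecPropositional as UniqueDec
import Data.List.Relation.Unary.Unique.DecPropositional.Properties as UniqueDecₚ
open import Function.Definitions using (Injective)
open import Function.Bundles using (Equivalence; mk⇔)
open import Data.Product using (_×_; _,_; proj₁; proj₂; ∃; ∃₂)
open import Data.Sum using (_⊎_; inj₁; inj₂; [_,_]′)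
open import Data.Bool using (true; false; if_then_else_)
open import Data.Empty using (⊥-elim)
open import Function using (_∘_; id)
open import Relation.Nullary using (Dec; yes; no; does; ¬_; ¬?)
open import Relation.Unary using (Decidable)
open import Relation.Nullary.Decidable using (_×-dec_; _⊎-dec_; map′; dec-true; dec-false; decidable-stable)
open import Relation.Binary.Definitions using (tri<; tri≈; tri>)
open import Relation.Binary.PropositionalEquality
  using (_≡_; _≢_; _≗_; refl; sym; trans; cong; cong₂; subst; subst₂; module ≡-Reasoning)
open import Algebra.Properties.Semiring.Sum ℕₚ.+-*-semiring
  using (sum; sum-cong-≗; ∑-distrib-+; sum-remove; sum-replicate-zero; *-distribˡ-sum)

private variable
  n : ℕ

[_] : ∀ {P : Set} → Dec P → ℕ
[ d ] = if does d then 1 else 0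

[]-yes : ∀ {P : Set} {d : Dec P} → P → [ d ] ≡ 1
[]-yes {d = yes _} _ = refl
[]-yes {d = no ¬p} p = ⊥-elim (¬p p)

[]-no : ∀ {P : Set} {d : Dec P} → ¬ P → [ d ] ≡ 0
[]-no {d = yes p} ¬p = ⊥-elim (¬p p)
[]-no {d = no _} _ = refl

[]-×-yes : ∀ {P Q : Set} {p? : Dec P} (q? : Dec Q) → P → [ p? ×-dec q? ] ≡ [ q? ]
[]-×-yes {p? = yes _} q? _ = refl
[]-×-yes {p? = no ¬p} q? p = ⊥-elim (¬p p)

listSum-allFin : (f : Fin n → ℕ) → ListAction.sum (List.map f (List.allFin n)) ≡ sum f
listSum-allFin f = trans (cong ListAction.sum (Listₚ.map-tabulate id f)) (listSum-tabulate f)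
  where
  listSum-tabulate : ∀ {m} (g : Fin m → ℕ) → ListAction.sum (List.tabulate g) ≡ sum g
  listSum-tabulate {zero} g = refl
  listSum-tabulate {suc m} g = cong (g zero +_) (listSum-tabulate (g ∘ suc))

infixl 6 _without_

_without_ : (Fin n → ℕ) → Fin n → Fin n → ℕ
(f without a) i = if does (i F.≟ a) then 0 else f i

without-at : (f : Fin n → ℕ) (a : Fin n) → (f without a) a ≡ 0
without-at f a with a F.≟ a
... | yes _ = refl
... | no a≢a = ⊥-elim (a≢a refl)

without-≢ : (f : Fin n → ℕ) {a i : Fin n} → i ≢ a → (f without a) i ≡ f i
without-≢ f {a} {i} i≢a with i F.≟ a
... | yes i≡a = ⊥-elim (i≢a i≡a)
... | no _ = refl

without-cong : {f g : Fin n → ℕ} (a : Fin n) → (∀ i → i ≢ a → f i ≡ g i) → f without a ≗ g without a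
without-cong a f≡g i with i F.≟ a
... | yes _ = refl
... | no i≢a = f≡g i i≢a

without-+ : (f g : Fin n → ℕ) (a : Fin n) →
            (λ i → f i + g i) without a ≗ λ i → (f without a) i + (g without a) i
without-+ f g a i with does (i F.≟ a)
... | true = refl
... | false = refl

without-vanishing : (f : Fin n → ℕ) (a : Fin n) → f a ≡ 0 → f without a ≗ f
without-vanishing f a fa≡0 i with i F.≟ a
... | yes refl = sym fa≡0
... | no _ = refl

without₂-vanishing : (f : Fin n → ℕ) {a b : Fin n} → f a ≡ 0 → f b ≡ 0 → f without a without b ≗ f
without₂-vanishing f {a} {b} fa≡0 fb≡0 c =
  trans (without-vanishing (f without a) b (trans (without-vanishing f a fa≡0 b) fb≡0) c) (without-vanishing f a fa≡0 c)

∑-without : (f : Fin n → ℕ) (a : Fin n) → sum f ≡ f a + sum (f without a)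
∑-without {suc n} f a = begin
  sum f                             ≡⟨ sum-remove {i = a} f ⟩
  f a + sum (f ∘ F.punchIn a)       ≡⟨ cong (f a +_) (sum-cong-≗ λ j → sym (without-≢ f (punchInᵢ≢i a j))) ⟩
  f a + (0 + sum (f⁻ ∘ F.punchIn a))  ≡⟨ cong (λ z → f a + (z + sum (f⁻ ∘ F.punchIn a))) (without-at f a) ⟨
  f a + (f⁻ a + sum (f⁻ ∘ F.punchIn a)) ≡⟨ cong (f a +_) (sum-remove {i = a} f⁻) ⟨
  f a + sum f⁻                      ∎
  where
  open ≡-Reasoning
  f⁻ : Fin (suc n) → ℕ
  f⁻ = f without a

≤-sum : (f : Fin n → ℕ) (i : Fin n) → f i ≤ sum f
≤-sum f i = ℕₚ.≤-trans (ℕₚ.m≤m+n (f i) _) (ℕₚ.≤-reflexive (sym (∑-without f i)))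

∑-without₂ : (f : Fin n → ℕ) {a b : Fin n} → a ≢ b → sum f ≡ f a + f b + sum (f without a without b)
∑-without₂ f {a} {b} a≢b = begin
  sum f                                     ≡⟨ ∑-without f a ⟩
  f a + sum (f without a)                   ≡⟨ cong (f a +_) (∑-without (f without a) b) ⟩
  f a + ((f without a) b + sum f⁻)          ≡⟨ cong (λ z → f a + (z + sum f⁻)) (without-≢ f (a≢b ∘ sym)) ⟩
  f a + (f b + sum f⁻)                      ≡⟨ ℕₚ.+-assoc (f a) (f b) _ ⟨
  f a + f b + sum f⁻                        ∎
  where
  open ≡-Reasoning
  f⁻ : Fin _ → ℕ
  f⁻ = f without a without b

without₂-cong : {f g : Fin n → ℕ} (a b : Fin n) → (∀ c → c ≢ a → c ≢ b → f c ≡ g c) →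
                f without a without b ≗ g without a without b
without₂-cong a b f≡g c with c F.≟ a | c F.≟ b
... | yes _ | _ = refl
... | no _ | yes _ = refl
... | no c≢a | no c≢b = f≡g c c≢a c≢b

∑-without₂-+ : (f g : Fin n → ℕ) (a b : Fin n) →
               sum ((λ c → f c + g c) without a without b) ≡ sum (f without a without b) + sum (g without a without b)
∑-without₂-+ f g a b =
  trans (sum-cong-≗ λ c → trans (without-cong b (λ c _ → without-+ f g a c) c) (without-+ (f without a) (g without a) b c))
        (∑-distrib-+ (f without a without b) (g without a without b))

cross : (Fin n → Fin n → ℕ) → Fin n → Fin n → Fin n → ℕ
cross F a b c = (F a c + F c a) + (F b c + F c b)

corner : (Fin n → Fin n → ℕ) → Fin n → Fin n → ℕ
corner F a b = F a a + F b b + (F a b + F b a)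

rest : (Fin n → Fin n → ℕ) → Fin n → Fin n → ℕ
rest F a b = sum ((λ i → sum (F i without a without b)) without a without b)

∑∑-split : (F : Fin n → Fin n → ℕ) {a b : Fin n} → a ≢ b →
           sum (λ i → sum (F i)) ≡ corner F a b + sum (cross F a b without a without b) + rest F a b
∑∑-split {n} F {a} {b} a≢b = begin
  sum row                                       ≡⟨ ∑-without₂ row a≢b ⟩
  row a + row b + sum (row without a without b)
    ≡⟨ cong₂ _+_ (cong₂ _+_ (∑-without₂ (F a) a≢b) (∑-without₂ (F b) a≢b)) rows ⟩
  (F a a + F a b + Ra) + (F b a + F b b + Rb) + (C + I) ≡⟨ regroup (F a a) (F a b) (F b a) (F b b) Ra Rb C I ⟩
  (F a a + F b b + (F a b + F b a)) + (Ra + C + Rb) + I ≡⟨ cong (λ z → _ + z + I) crosses ⟨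
  (F a a + F b b + (F a b + F b a)) + sum (cross F a b without a without b) + I ∎
  where
  open ≡-Reasoning
  row col inner : Fin n → ℕ
  row i = sum (F i)
  col i = F i a + F i b
  inner i = sum (F i without a without b)
  Ra Rb C I : ℕ
  Ra = sum (F a without a without b)
  Rb = sum (F b without a without b)
  C = sum (col without a without b)
  I = sum (inner without a without b)
  rows : sum (row without a without b) ≡ C + I
  rows = trans (sum-cong-≗ (without₂-cong a b λ i _ _ → ∑-without₂ (F i) a≢b)) (∑-without₂-+ col inner a b)
  crosses : sum (cross F a b without a without b) ≡ Ra + C + Rb
  crosses = begin
    sum (cross F a b without a without b)
      ≡⟨ sum-cong-≗ (without₂-cong a b λ c _ _ → shuffle (F a c) (F c a) (F b c) (F c b)) ⟩
    sum ((λ c → F a c + col c + F b c) without a without b)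
      ≡⟨ ∑-without₂-+ (λ c → F a c + col c) (F b) a b ⟩
    sum ((λ c → F a c + col c) without a without b) + Rb
      ≡⟨ cong (_+ Rb) (∑-without₂-+ (F a) col a b) ⟩
    Ra + C + Rb ∎
    where
    shuffle : ∀ p q r s → (p + q) + (r + s) ≡ p + (q + s) + r
    shuffle = solve-∀
  regroup : ∀ p q r s x y z t → (p + q + x) + (r + s + y) + (z + t) ≡ (p + s + (q + r)) + (x + z + y) + t
  regroup = solve-∀

inversion : ∀ {m} (i j : Fin n) (x y : Fin m) → ℕ
inversion i j x y = [ (i <? j) ×-dec (y <? x) ]

inversion≡1 : ∀ {m} {i j : Fin n} {x y : Fin m} → i F.< j → y F.< x → inversion i j x y ≡ 1
inversion≡1 {i = i} {j} {x} {y} i<j y<x = []-yes {d = (i <? j) ×-dec (y <? x)} (i<j , y<x)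

Inversions : Word n → Fin n → Fin n → ℕ
Inversions w i j = inversion i j (lookup w i) (lookup w j)

inv≡∑∑ : (w : Word n) → inv w ≡ sum (λ i → sum (Inversions w i))
inv≡∑∑ {n} w = trans (listSum-allFin row) (sum-cong-≗ λ i → listSum-allFin (Inversions w i))
  where
  row : Fin n → ℕ
  row i = ListAction.sum (List.map (Inversions w i) (List.allFin n))

discord : ∀ {m} (i j : Fin n) (x y : Fin m) → ℕ
discord i j x y = inversion i j x y + inversion j i y x

discord-< : ∀ {m} {i j : Fin n} (x y : Fin m) → i F.< j → discord i j x y ≡ [ y <? x ]
discord-< {i = i} {j} x y i<j =
  trans (cong₂ _+_ ([]-×-yes {p? = i <? j} (y <? x) i<j)
                   ([]-no {d = (j <? i) ×-dec (x <? y)} λ (j<i , _) → Fₚ.<-asym i<j j<i))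
        (ℕₚ.+-identityʳ _)

discord-> : ∀ {m} {i j : Fin n} (x y : Fin m) → j F.< i → discord i j x y ≡ [ x <? y ]
discord-> {i = i} {j} x y j<i =
  cong₂ _+_ ([]-no {d = (i <? j) ×-dec (y <? x)} λ (i<j , _) → Fₚ.<-asym i<j j<i) ([]-×-yes {p? = j <? i} (x <? y) j<i)

bracket-shift : ∀ {m} {A B C : Fin m} → B F.< A → C ≢ A → C ≢ B →
  [ C <? A ] + [ B <? C ] ≡ [ C <? B ] + [ A <? C ] + 2 * [ (B <? C) ×-dec (C <? A) ]
bracket-shift {A = A} {B} {C} B<A C≢A C≢B with Fₚ.<-cmp C B | Fₚ.<-cmp C A
... | tri≈ _ C≡B _ | _ = ⊥-elim (C≢B C≡B)
... | _ | tri≈ _ C≡A _ = ⊥-elim (C≢A C≡A)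
... | tri< C<B _ B≮C | _
  rewrite dec-true (C <? A) (Fₚ.<-trans C<B B<A) | dec-false (B <? C) B≮C
        | dec-true (C <? B) C<B | dec-false (A <? C) (Fₚ.<-asym (Fₚ.<-trans C<B B<A)) = refl
... | tri> C≮B _ B<C | tri< C<A _ A≮C
  rewrite dec-true (C <? A) C<A | dec-true (B <? C) B<C | dec-false (C <? B) C≮B | dec-false (A <? C) A≮C = refl
... | tri> C≮B _ B<C | tri> C≮A _ A<C
  rewrite dec-false (C <? A) C≮A | dec-true (B <? C) B<C | dec-false (C <? B) C≮B | dec-true (A <? C) A<C = refl

discord-swap : ∀ {m} {a b c : Fin n} {A B C : Fin m} →
  a F.< b → B F.< A → c ≢ a → c ≢ b → C ≢ A → C ≢ B →
  discord a c A C + discord b c B C ≡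
  discord a c B C + discord b c A C + 2 * [ (a <? c) ×-dec (c <? b) ×-dec (B <? C) ×-dec (C <? A) ]
discord-swap {a = a} {b} {c} {A} {B} {C} a<b B<A c≢a c≢b C≢A C≢B with Fₚ.<-cmp c a | Fₚ.<-cmp c b
... | tri≈ _ c≡a _ | _ = ⊥-elim (c≢a c≡a)
... | _ | tri≈ _ c≡b _ = ⊥-elim (c≢b c≡b)
... | tri< c<a _ _ | tri> _ _ b<c = ⊥-elim (Fₚ.<-asym c<a (Fₚ.<-trans a<b b<c))
... | tri< c<a _ a≮c | tri< c<b _ _
  rewrite discord-> {i = a} A C c<a | discord-> {i = b} B C c<b
        | discord-> {i = a} B C c<a | discord-> {i = b} A C c<b
        | []-no {d = (a <? c) ×-dec (c <? b) ×-dec (B <? C) ×-dec (C <? A)} (a≮c ∘ proj₁)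
  = trans (ℕₚ.+-comm [ A <? C ] _) (sym (ℕₚ.+-identityʳ _))
... | tri> _ _ a<c | tri> _ _ b<c
  rewrite discord-< {i = a} A C a<c | discord-< {i = b} B C b<c
        | discord-< {i = a} B C a<c | discord-< {i = b} A C b<c
        | []-no {d = (a <? c) ×-dec (c <? b) ×-dec (B <? C) ×-dec (C <? A)} (λ (_ , c<b , _) → Fₚ.<-asym c<b b<c)
  = trans (ℕₚ.+-comm [ C <? A ] _) (sym (ℕₚ.+-identityʳ _))
... | tri> _ _ a<c | tri< c<b _ _
  rewrite discord-< {i = a} A C a<c | discord-> {i = b} B C c<b
        | discord-< {i = a} B C a<c | discord-> {i = b} A C c<b
        | []-×-yes {p? = a <? c} ((c <? b) ×-dec (B <? C) ×-dec (C <? A)) a<c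
        | []-×-yes {p? = c <? b} ((B <? C) ×-dec (C <? A)) c<b
  = bracket-shift B<A C≢A C≢B

transpose-i : (i j : Fin n) → transpose i j i ≡ j
transpose-i i j with i F.≟ i
... | yes _ = refl
... | no i≢i = ⊥-elim (i≢i refl)

transpose-j : (i j : Fin n) → transpose i j j ≡ i
transpose-j i j with j F.≟ i
... | yes j≡i = j≡i
... | no _ with j F.≟ j
...   | yes _ = refl
...   | no j≢j = ⊥-elim (j≢j refl)

transpose-≢ : (i j : Fin n) {k : Fin n} → k ≢ i → k ≢ j → transpose i j k ≡ k
transpose-≢ i j {k} k≢i k≢j with k F.≟ i
... | yes k≡i = ⊥-elim (k≢i k≡i)
... | no _ with k F.≟ j
...   | yes k≡j = ⊥-elim (k≢j k≡j)
...   | no _ = refl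

transpose-comm : (i j k : Fin n) → transpose i j k ≡ transpose j i k
transpose-comm i j k = by-cases (k F.≟ i) (k F.≟ j)
  where
  by-cases : Dec (k ≡ i) → Dec (k ≡ j) → transpose i j k ≡ transpose j i k
  by-cases (yes refl) (yes refl) = refl
  by-cases (yes refl) (no _) = trans (transpose-i k j) (sym (transpose-j j k))
  by-cases (no _) (yes refl) = trans (transpose-j i k) (sym (transpose-i k i))
  by-cases (no k≢i) (no k≢j) = trans (transpose-≢ i j k≢i k≢j) (sym (transpose-≢ j i k≢j k≢i))

transpose-involutive : (i j k : Fin n) → transpose i j (transpose i j k) ≡ k
transpose-involutive i j k = trans (cong (transpose i j) (transpose-comm i j k)) (transpose-inverse i j)

lookup-·t : (w : Word n) (i j k : Fin n) → lookup (w ·t[ i , j ]) k ≡ lookup w (transpose i j k)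
lookup-·t w i j k = lookup∘tabulate (lookup w ∘ transpose i j) k

lookup-·t-i : (w : Word n) (i j : Fin n) → lookup (w ·t[ i , j ]) i ≡ lookup w j
lookup-·t-i w i j = trans (lookup-·t w i j i) (cong (lookup w) (transpose-i i j))

lookup-·t-j : (w : Word n) (i j : Fin n) → lookup (w ·t[ i , j ]) j ≡ lookup w i
lookup-·t-j w i j = trans (lookup-·t w i j j) (cong (lookup w) (transpose-j i j))

lookup-·t-≢ : (w : Word n) (i j : Fin n) {k : Fin n} → k ≢ i → k ≢ j → lookup (w ·t[ i , j ]) k ≡ lookup w k
lookup-·t-≢ w i j k≢i k≢j = trans (lookup-·t w i j _) (cong (lookup w) (transpose-≢ i j k≢i k≢j))

·t-comm : (w : Word n) (i j : Fin n) → w ·t[ i , j ] ≡ w ·t[ j , i ]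
·t-comm w i j = tabulate-cong λ k → cong (lookup w) (transpose-comm i j k)

·t-involutive : (w : Word n) (i j : Fin n) → (w ·t[ i , j ]) ·t[ i , j ] ≡ w
·t-involutive w i j = trans (tabulate-cong λ k → trans (lookup-·t w i j (transpose i j k))
                                                     (cong (lookup w) (transpose-involutive i j k)))
                           (tabulate∘lookup w)

transpose-moved : (i j : Fin n) {x : Fin n} → transpose i j x ≢ x → x ≡ i ⊎ x ≡ j
transpose-moved i j {x} moved = by-cases (x F.≟ i)
  where
  by-cases : Dec (x ≡ i) → x ≡ i ⊎ x ≡ j
  by-cases (yes x≡i) = inj₁ x≡i
  by-cases (no x≢i) = inj₂ (decidable-stable (x F.≟ j) λ x≢j → moved (transpose-≢ i j x≢i x≢j))

toList-tabulate : ∀ {A : Set} (f : Fin n → A) → toList (tabulate f) ≡ List.tabulate f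
toList-tabulate {zero} f = refl
toList-tabulate {suc n} f = cong (f zero List.∷_) (toList-tabulate (f ∘ suc))

unique-tabulate⁻ : ∀ {A : Set} {f : Fin n → A} → Unique (List.tabulate f) → Injective _≡_ _≡_ f
unique-tabulate⁻ {suc n} _ {zero} {zero} _ = refl
unique-tabulate⁻ {suc n} (f0∉ ∷ _) {zero} {suc j} f0≡fj = ⊥-elim (Allₚ.tabulate⁻ f0∉ j f0≡fj)
unique-tabulate⁻ {suc n} (f0∉ ∷ _) {suc i} {zero} fi≡f0 = ⊥-elim (Allₚ.tabulate⁻ f0∉ i (sym fi≡f0))
unique-tabulate⁻ {suc n} (_ ∷ unique) {suc i} {suc j} fi≡fj = cong suc (unique-tabulate⁻ unique fi≡fj)

IsPerm-tabulate : {f : Fin n → Fin n} → Injective _≡_ _≡_ f → IsPerm (tabulate f)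
IsPerm-tabulate {f = f} f-inj = subst Unique (sym (toList-tabulate f)) (Uniqueₚ.tabulate⁺ f-inj)

IsPerm⇒injective : {w : Word n} → IsPerm w → Injective _≡_ _≡_ (lookup w)
IsPerm⇒injective {w = w} w-perm =
  unique-tabulate⁻ (subst Unique (toList-tabulate (lookup w)) (subst IsPerm (sym (tabulate∘lookup w)) w-perm))

∘transpose-injective : ∀ {A : Set} {f : Fin n → A} (i j : Fin n) →
                       Injective _≡_ _≡_ f → Injective _≡_ _≡_ (f ∘ transpose i j)
∘transpose-injective i j f-inj e =
  trans (sym (transpose-involutive i j _)) (trans (cong (transpose i j) (f-inj e)) (transpose-involutive i j _))

IsPerm-·t : {w : Word n} (i j : Fin n) → IsPerm w → IsPerm (w ·t[ i , j ])
IsPerm-·t i j w-perm = IsPerm-tabulate (∘transpose-injective i j (IsPerm⇒injective w-perm))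

-- Inversions of w and w·(a b)

corner-inversions : (w : Word n) {a b : Fin n} → a F.< b → corner (Inversions w) a b ≡ [ lookup w b <? lookup w a ]
corner-inversions w {a} {b} a<b
  rewrite []-no {d = (a <? a) ×-dec (lookup w a <? lookup w a)} (Fₚ.<-irrefl refl ∘ proj₁)
        | []-no {d = (b <? b) ×-dec (lookup w b <? lookup w b)} (Fₚ.<-irrefl refl ∘ proj₁)
  = discord-< (lookup w a) (lookup w b) a<b

middle : Word n → Fin n → Fin n → Fin n → ℕ
middle w a b c = [ (a <? c) ×-dec (c <? b) ×-dec (lookup w b <? lookup w c) ×-dec (lookup w c <? lookup w a) ]

cross-inversions-·t : (w : Word n) {a b c : Fin n} → Injective _≡_ _≡_ (lookup w) → a F.< b →
  lookup w b F.< lookup w a → c ≢ a → c ≢ b →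
  cross (Inversions w) a b c ≡ cross (Inversions (w ·t[ a , b ])) a b c + 2 * middle w a b c
cross-inversions-·t w {a} {b} {c} w-inj a<b wb<wa c≢a c≢b =
  trans (discord-swap a<b wb<wa c≢a c≢b (c≢a ∘ w-inj) (c≢b ∘ w-inj))
        (cong (_+ 2 * middle w a b c) (sym (cong₂ _+_ (cong₂ (discord a c) (lookup-·t-i w a b) wc)
                                                       (cong₂ (discord b c) (lookup-·t-j w a b) wc))))
  where
  wc : lookup (w ·t[ a , b ]) c ≡ lookup w c
  wc = lookup-·t-≢ w a b c≢a c≢b

∑-cross-inversions-·t : (w : Word n) {a b : Fin n} → Injective _≡_ _≡_ (lookup w) → a F.< b →
  lookup w b F.< lookup w a →
  sum (cross (Inversions w) a b without a without b) ≡
  sum (cross (Inversions (w ·t[ a , b ])) a b without a without b) + 2 * sum (middle w a b)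
∑-cross-inversions-·t {n} w {a} {b} w-inj a<b wb<wa = begin
  sum (cross F a b without a without b)
    ≡⟨ sum-cong-≗ (without₂-cong a b λ c → cross-inversions-·t w w-inj a<b wb<wa) ⟩
  sum ((λ c → cross G a b c + twice-middle c) without a without b)
    ≡⟨ ∑-without₂-+ (cross G a b) twice-middle a b ⟩
  sum (cross G a b without a without b) + sum (twice-middle without a without b)
    ≡⟨ cong (crossSum +_) (sum-cong-≗ (without₂-vanishing twice-middle twice-middle-a twice-middle-b)) ⟩
  sum (cross G a b without a without b) + sum twice-middle
    ≡⟨ cong (crossSum +_) (*-distribˡ-sum 2 (middle w a b)) ⟨
  sum (cross G a b without a without b) + 2 * sum (middle w a b) ∎
  where
  open ≡-Reasoning
  v : Fin n → Fin n
  v = lookup w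
  F G : Fin n → Fin n → ℕ
  F = Inversions w
  G = Inversions (w ·t[ a , b ])
  crossSum : ℕ
  crossSum = sum (cross G a b without a without b)
  twice-middle : Fin n → ℕ
  twice-middle c = 2 * middle w a b c
  twice-middle-a : twice-middle a ≡ 0
  twice-middle-a = cong (2 *_) ([]-no {d = (a <? a) ×-dec (a <? b) ×-dec (v b <? v a) ×-dec (v a <? v a)}
                                      (Fₚ.<-irrefl refl ∘ proj₁))
  twice-middle-b : twice-middle b ≡ 0
  twice-middle-b = cong (2 *_) ([]-no {d = (a <? b) ×-dec (b <? b) ×-dec (v b <? v b) ×-dec (v b <? v a)}
                                      λ (_ , b<b , _) → Fₚ.<-irrefl refl b<b)

inv-·t : (w : Word n) {a b : Fin n} → Injective _≡_ _≡_ (lookup w) → a F.< b → lookup w b F.< lookup w a →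
         inv w ≡ suc (inv (w ·t[ a , b ]) + 2 * sum (middle w a b))
inv-·t {n} w {a} {b} w-inj a<b wb<wa = begin
  inv w                                           ≡⟨ trans (inv≡∑∑ w) (∑∑-split F a≢b) ⟩
  corner F a b + crossSum F + rest F a b
    ≡⟨ cong₂ _+_ (cong₂ _+_ cornerF (∑-cross-inversions-·t w w-inj a<b wb<wa)) restF ⟩
  1 + (crossSum G + 2 * M) + rest G a b           ≡⟨ regroup (crossSum G) (rest G a b) (2 * M) ⟩
  suc (0 + crossSum G + rest G a b + 2 * M)       ≡⟨ cong (λ z → suc (z + crossSum G + rest G a b + 2 * M)) cornerG ⟨
  suc (corner G a b + crossSum G + rest G a b + 2 * M)
    ≡⟨ cong (λ z → suc (z + 2 * M)) (trans (inv≡∑∑ w') (∑∑-split G a≢b)) ⟨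
  suc (inv w' + 2 * M)                            ∎
  where
  open ≡-Reasoning
  a≢b : a ≢ b
  a≢b = Fₚ.<⇒≢ a<b
  w' : Word n
  w' = w ·t[ a , b ]
  v : Fin n → Fin n
  v = lookup w
  F G : Fin n → Fin n → ℕ
  F = Inversions w
  G = Inversions w'
  M : ℕ
  M = sum (middle w a b)
  crossSum : (Fin n → Fin n → ℕ) → ℕ
  crossSum H = sum (cross H a b without a without b)
  cornerF : corner F a b ≡ 1
  cornerF = trans (corner-inversions w a<b) ([]-yes {d = v b <? v a} wb<wa)
  cornerG : corner G a b ≡ 0
  cornerG = trans (corner-inversions w' a<b) ([]-no {d = lookup w' b <? lookup w' a} λ lt →
              Fₚ.<-asym wb<wa (subst₂ F._<_ (lookup-·t-j w a b) (lookup-·t-i w a b) lt))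
  restF : rest F a b ≡ rest G a b
  restF = sum-cong-≗ (without₂-cong a b λ i i≢a i≢b → sum-cong-≗ (without₂-cong a b λ j j≢a j≢b →
            sym (cong₂ (inversion i j) (lookup-·t-≢ w a b i≢a i≢b) (lookup-·t-≢ w a b j≢a j≢b))))
  regroup : ∀ x y z → 1 + (x + z) + y ≡ suc (0 + x + y + z)
  regroup = solve-∀

inv-·t-< : (w : Word n) {a b : Fin n} → Injective _≡_ _≡_ (lookup w) → a F.< b → lookup w b F.< lookup w a →
           inv (w ·t[ a , b ]) < inv w
inv-·t-< w w-inj a<b wb<wa =
  ℕₚ.≤-trans (s≤s (ℕₚ.m≤m+n _ _)) (ℕₚ.≤-reflexive (sym (inv-·t w w-inj a<b wb<wa)))

NothingBetween : Word n → Fin n → Fin n → Set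
NothingBetween w a b = ∀ c → a F.< c → c F.< b → ¬ (lookup w b F.< lookup w c × lookup w c F.< lookup w a)

inv-·t-nothingBetween : (w : Word n) {a b : Fin n} → Injective _≡_ _≡_ (lookup w) → a F.< b →
  lookup w b F.< lookup w a → NothingBetween w a b → inv w ≡ suc (inv (w ·t[ a , b ]))
inv-·t-nothingBetween {n} w {a} {b} w-inj a<b wb<wa empty = begin
  inv w                                               ≡⟨ inv-·t w w-inj a<b wb<wa ⟩
  suc (inv (w ·t[ a , b ]) + 2 * sum (middle w a b))  ≡⟨ cong (λ m → suc (inv (w ·t[ a , b ]) + 2 * m)) no-middle ⟩
  suc (inv (w ·t[ a , b ]) + 0)                       ≡⟨ cong suc (ℕₚ.+-identityʳ _) ⟩
  suc (inv (w ·t[ a , b ]))                           ∎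
  where
  open ≡-Reasoning
  no-middle : sum (middle w a b) ≡ 0
  no-middle = trans (sum-cong-≗ middle≡0) (sum-replicate-zero n)
    where
    middle≡0 : ∀ c → middle w a b c ≡ 0
    middle≡0 c = []-no {d = (a <? c) ×-dec (c <? b) ×-dec (lookup w b <? lookup w c) ×-dec (lookup w c <? lookup w a)}
                   λ (a<c , c<b , between) → empty c a<c c<b between

≤B-inv : {u w : Word n} → u ≤B w → inv u ≤ inv w
≤B-inv ≤B-refl = ℕₚ.≤-refl
≤B-inv (≤B-step _ _ _ lt u≤v) = ℕₚ.≤-trans (≤B-inv u≤v) (ℕₚ.<⇒≤ lt)

≤B-IsPerm : {u w : Word n} → IsPerm u → u ≤B w → IsPerm w
≤B-IsPerm u-perm ≤B-refl = u-perm
≤B-IsPerm u-perm (≤B-step i j _ _ u≤v) = IsPerm-·t i j (≤B-IsPerm u-perm u≤v)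

≤B-trans : {u v w : Word n} → u ≤B v → v ≤B w → u ≤B w
≤B-trans u≤v ≤B-refl = u≤v
≤B-trans u≤v (≤B-step i j i≢j lt v≤x) = ≤B-step i j i≢j lt (≤B-trans u≤v v≤x)

≤B-·t : (w : Word n) {i j : Fin n} → i ≢ j → inv (w ·t[ i , j ]) < inv w → (w ·t[ i , j ]) ≤B w
≤B-·t w {i} {j} i≢j lt = subst ((w ·t[ i , j ]) ≤B_) (·t-involutive w i j)
  (≤B-step i j i≢j (subst (λ v → inv (w ·t[ i , j ]) < inv v) (sym (·t-involutive w i j)) lt) ≤B-refl)

StepsDownTo : Word n → Word n → Set
StepsDownTo {n} u w = ∃₂ λ (i j : Fin n) → i ≢ j × inv (w ·t[ i , j ]) < inv w × u ≤B (w ·t[ i , j ])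

≤B-unstep : {u w : Word n} → u ≤B w → u ≡ w ⊎ StepsDownTo u w
≤B-unstep ≤B-refl = inj₁ refl
≤B-unstep {u = u} (≤B-step {v} i j i≢j lt u≤v) =
  inj₂ (i , j , i≢j , subst (λ x → inv x < inv (v ·t[ i , j ])) (sym (·t-involutive v i j)) lt
                    , subst (u ≤B_) (sym (·t-involutive v i j)) u≤v)

≤B-restep : {u w : Word n} → StepsDownTo u w → u ≤B w
≤B-restep {u = u} {w} (i , j , i≢j , lt , u≤wt) = ≤B-trans u≤wt (≤B-·t w i≢j lt)

_≟W_ : (u w : Word n) → Dec (u ≡ w)
_≟W_ = Vecₚ.≡-dec F._≟_

≤B-bounded? : (fuel : ℕ) (u w : Word n) → inv w < fuel → Dec (u ≤B w)
≤B-bounded? zero u w ()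
≤B-bounded? (suc fuel) u w w<fuel =
  map′ [ (λ { refl → ≤B-refl }) , ≤B-restep ]′ ≤B-unstep
       ((u ≟W w) ⊎-dec Fₚ.any? λ i → Fₚ.any? λ j → step? i j)
  where
  step? : ∀ i j → Dec (i ≢ j × inv (w ·t[ i , j ]) < inv w × u ≤B (w ·t[ i , j ]))
  step? i j with inv (w ·t[ i , j ]) ℕ.<? inv w
  ... | no ≮ = no (≮ ∘ proj₁ ∘ proj₂)
  ... | yes lt = ¬? (i F.≟ j) ×-dec yes lt ×-dec ≤B-bounded? fuel u _ (ℕₚ.<-≤-trans lt (ℕₚ.≤-pred w<fuel))

_≤B?_ : (u w : Word n) → Dec (u ≤B w)
u ≤B? w = ≤B-bounded? (suc (inv w)) u w ℕₚ.≤-refl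

-- Permutations with at most one inversion

inv≡0⇒sorted : (u : Word n) → inv u ≡ 0 → ∀ {i j} → i F.< j → ¬ lookup u j F.< lookup u i
inv≡0⇒sorted u inv≡0 {i} {j} i<j uj<ui = ℕₚ.<-irrefl refl (begin-strict
  0                                  <⟨ ℕₚ.≤-reflexive (sym (inversion≡1 i<j uj<ui)) ⟩
  Inversions u i j                   ≤⟨ ≤-sum (Inversions u i) j ⟩
  sum (Inversions u i)               ≤⟨ ≤-sum (λ i → sum (Inversions u i)) i ⟩
  sum (λ i → sum (Inversions u i))   ≡⟨ trans (sym (inv≡∑∑ u)) inv≡0 ⟩
  0                                  ∎)
  where open ℕₚ.≤-Reasoning

increasing⇒≥ : (f : Fin n → ℕ) → (∀ {i j} → i F.< j → f i < f j) → ∀ i → toℕ i ≤ f i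
increasing⇒≥ f f-inc zero = z≤n
increasing⇒≥ {suc n} f f-inc (suc i) = begin
  suc (toℕ i)           ≤⟨ s≤s (increasing⇒≥ g g-inc i) ⟩
  suc (f (suc i) ∸ 1)   ≡⟨ trans (ℕₚ.+-comm 1 _) (ℕₚ.m∸n+n≡m (positive i)) ⟩
  f (suc i)             ∎
  where
  open ℕₚ.≤-Reasoning
  positive : ∀ k → 1 ≤ f (suc k)
  positive k = ℕₚ.≤-trans (s≤s z≤n) (f-inc {zero} {suc k} (s≤s z≤n))
  g : Fin n → ℕ
  g k = f (suc k) ∸ 1
  g-inc : ∀ {i j} → i F.< j → g i < g j
  g-inc {i} i<j = ℕₚ.∸-monoˡ-< (f-inc (s≤s i<j)) (positive i)

opposite-< : {i j : Fin n} → i F.< j → F.opposite j F.< F.opposite i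
opposite-< {i = i} {j} i<j = subst₂ ℕ._<_ (sym (Fₚ.opposite-prop j)) (sym (Fₚ.opposite-prop i))
                                      (ℕₚ.∸-monoʳ-< (s≤s i<j) (Fₚ.toℕ<n j))

-- The lower bound, applied to f conjugated by opposite, is also an upper bound.
increasing⇒identity : (f : Fin n → Fin n) → (∀ {i j} → i F.< j → f i F.< f j) → ∀ i → f i ≡ i
increasing⇒identity f f-inc i =
  Fₚ.toℕ-injective (ℕₚ.≤-antisym (ℕₚ.≮⇒≥ i≮fi) (increasing⇒≥ (toℕ ∘ f) f-inc i))
  where
  f̃ : Fin _ → Fin _
  f̃ = F.opposite ∘ f ∘ F.opposite
  f̃-above : toℕ (F.opposite i) ≤ toℕ (F.opposite (f i))
  f̃-above = subst (λ k → toℕ (F.opposite i) ≤ toℕ (F.opposite (f k))) (Fₚ.opposite-involutive i)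
              (increasing⇒≥ (toℕ ∘ f̃) (opposite-< ∘ f-inc ∘ opposite-<) (F.opposite i))
  i≮fi : ¬ i F.< f i
  i≮fi i<fi = ℕₚ.<⇒≱ (opposite-< i<fi) f̃-above

inv≡0⇒identity : (u : Word n) → IsPerm u → inv u ≡ 0 → u ≡ tabulate id
inv≡0⇒identity u u-perm inv≡0 = trans (sym (tabulate∘lookup u)) (tabulate-cong (increasing⇒identity (lookup u) u-inc))
  where
  u-inc : ∀ {i j} → i F.< j → lookup u i F.< lookup u j
  u-inc i<j = Fₚ.≤∧≢⇒< (ℕₚ.≮⇒≥ (inv≡0⇒sorted u inv≡0 i<j)) (Fₚ.<⇒≢ i<j ∘ IsPerm⇒injective u-perm)

-- tabulate id ·t[ p , q ] with q = p + 1 is the simple transposition s_p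
Adjacent : Fin n → Fin n → Set
Adjacent p q = toℕ q ≡ suc (toℕ p)

Adjacent⇒< : {p q : Fin n} → Adjacent p q → p F.< q
Adjacent⇒< q≡1+p = ℕₚ.≤-reflexive (sym q≡1+p)

Adjacent⇒nothingBetween : (u : Word n) {p q : Fin n} → Adjacent p q → NothingBetween u p q
Adjacent⇒nothingBetween u q≡1+p c p<c c<q _ =
  ℕₚ.<-irrefl refl (ℕₚ.<-≤-trans c<q (subst (_≤ toℕ c) (sym q≡1+p) p<c))

noAdjacentDescent⇒inv≡0 : (u : Word n) → (∀ p q → Adjacent p q → ¬ lookup u q F.< lookup u p) → inv u ≡ 0
noAdjacentDescent⇒inv≡0 {n} u no-descent = begin
  inv u                              ≡⟨ inv≡∑∑ u ⟩
  sum (λ i → sum (Inversions u i))   ≡⟨ sum-cong-≗ (λ i → trans (sum-cong-≗ (no-inversion i)) (sum-replicate-zero n)) ⟩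
  sum {n} (λ _ → 0)                  ≡⟨ sum-replicate-zero n ⟩
  0                                  ∎
  where
  open ≡-Reasoning
  v = lookup u
  weakly-increasing : ∀ d i j → toℕ j ≡ d + toℕ i → v i F.≤ v j
  weakly-increasing zero i j j≡i = ℕₚ.≤-reflexive (cong (toℕ ∘ v) (sym (Fₚ.toℕ-injective j≡i)))
  weakly-increasing (suc d) i j j≡1+d+i =
    ℕₚ.≤-trans (ℕₚ.≮⇒≥ (no-descent i next (Fₚ.toℕ-fromℕ< 1+i<n)))
               (weakly-increasing d next j (trans j≡1+d+i (trans (sym (ℕₚ.+-suc d (toℕ i))) (cong (d +_) (sym (Fₚ.toℕ-fromℕ< 1+i<n))))))
    where
    1+i<n : suc (toℕ i) < n
    1+i<n = ℕₚ.≤-<-trans (subst (suc (toℕ i) ≤_) (sym j≡1+d+i) (s≤s (ℕₚ.m≤n+m (toℕ i) d))) (Fₚ.toℕ<n j)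
    next : Fin n
    next = F.fromℕ< 1+i<n
  no-inversion : ∀ i j → Inversions u i j ≡ 0
  no-inversion i j = []-no {d = (i <? j) ×-dec (v j <? v i)} λ (i<j , vj<vi) →
    ℕₚ.<⇒≱ vj<vi (weakly-increasing (toℕ j ∸ toℕ i) i j (sym (ℕₚ.m∸n+n≡m (ℕₚ.<⇒≤ i<j))))

inv≡1⇒adjacentTransposition : (u : Word n) → IsPerm u → inv u ≡ 1 →
  ∃₂ λ p q → Adjacent p q × lookup u q F.< lookup u p × u ≡ tabulate id ·t[ p , q ]
inv≡1⇒adjacentTransposition u u-perm inv≡1
  with Fₚ.any? (λ p → Fₚ.any? λ q → (toℕ q ℕ.≟ suc (toℕ p)) ×-dec (lookup u q <? lookup u p))
... | no no-descent = ⊥-elim (ℕₚ.1+n≢0 (trans (sym inv≡1)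
        (noAdjacentDescent⇒inv≡0 u λ p q adj desc → no-descent (p , q , adj , desc))))
... | yes (p , q , adj , desc) = p , q , adj , desc , (begin
  u                               ≡⟨ ·t-involutive u p q ⟨
  (u ·t[ p , q ]) ·t[ p , q ]     ≡⟨ cong _·t[ p , q ] (inv≡0⇒identity (u ·t[ p , q ]) (IsPerm-·t p q u-perm) inv≡0) ⟩
  tabulate id ·t[ p , q ]         ∎)
  where
  open ≡-Reasoning
  inv≡0 : inv (u ·t[ p , q ]) ≡ 0
  inv≡0 = ℕₚ.suc-injective (trans (sym (inv-·t-nothingBetween u (IsPerm⇒injective u-perm) (Adjacent⇒< adj) desc
                                                                    (Adjacent⇒nothingBetween u adj))) inv≡1)

-- Inversions across a cut

CutInversion : Word n → Fin n → Set
CutInversion {n} w p = ∃₂ λ (c k : Fin n) → c F.≤ p × p F.< k × lookup w k F.< lookup w c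

lookup-·t-transpose : (w : Word n) (i j k : Fin n) → lookup (w ·t[ i , j ]) (transpose i j k) ≡ lookup w k
lookup-·t-transpose w i j k = trans (lookup-·t w i j (transpose i j k)) (cong (lookup w) (transpose-involutive i j k))

·t-moved : (w : Word n) (i j : Fin n) {x : Fin n} → transpose i j x ≢ x → w ·t[ i , j ] ≡ w ·t[ x , transpose i j x ]
·t-moved w i j moved with transpose-moved i j moved
... | inj₁ refl = cong (w ·t[ i ,_]) (sym (transpose-i i j))
... | inj₂ refl = trans (·t-comm w i j) (cong (w ·t[ j ,_]) (sym (transpose-j i j)))

straddling-step : (v : Word n) {x y p : Fin n} → IsPerm v → x F.≤ p → p F.< y →
                  inv v < inv (v ·t[ x , y ]) → CutInversion (v ·t[ x , y ]) p
straddling-step v {x} {y} v-perm x≤p p<y v<vt = x , y , x≤p , p<y ,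
  subst₂ F._<_ (sym (lookup-·t-j v x y)) (sym (lookup-·t-i v x y)) vx<vy
  where
  x<y : x F.< y
  x<y = ℕₚ.≤-<-trans x≤p p<y
  vx<vy : lookup v x F.< lookup v y
  vx<vy = Fₚ.≤∧≢⇒< (ℕₚ.≮⇒≥ λ vy<vx → ℕₚ.<-asym v<vt (inv-·t-< v (IsPerm⇒injective v-perm) x<y vy<vx))
                   (Fₚ.<⇒≢ x<y ∘ IsPerm⇒injective v-perm)

CutInversion-·t : (v : Word n) (i j : Fin n) {p : Fin n} → IsPerm v → inv v < inv (v ·t[ i , j ]) →
                  CutInversion v p → CutInversion (v ·t[ i , j ]) p
CutInversion-·t v i j {p} v-perm v<vt (c , k , c≤p , p<k , vk<vc) with transpose i j c Fₚ.≤? p | p <? transpose i j k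
... | yes tc≤p | yes p<tk = transpose i j c , transpose i j k , tc≤p , p<tk ,
  subst₂ F._<_ (sym (lookup-·t-transpose v i j k)) (sym (lookup-·t-transpose v i j c)) vk<vc
... | no tc≰p | _ = subst (λ x → CutInversion x p) (sym moved-c)
  (straddling-step v v-perm c≤p (ℕₚ.≰⇒> tc≰p) (subst (λ x → inv v < inv x) moved-c v<vt))
  where
  moved-c : v ·t[ i , j ] ≡ v ·t[ c , transpose i j c ]
  moved-c = ·t-moved v i j λ tc≡c → tc≰p (subst (F._≤ p) (sym tc≡c) c≤p)
... | yes _ | no p≮tk = subst (λ x → CutInversion x p) (sym moved-k)
  (straddling-step v v-perm (ℕₚ.≮⇒≥ p≮tk) p<k (subst (λ x → inv v < inv x) moved-k v<vt))
  where
  moved-k : v ·t[ i , j ] ≡ v ·t[ transpose i j k , k ]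
  moved-k = trans (·t-moved v i j λ tk≡k → p≮tk (subst (p F.<_) (sym tk≡k) p<k)) (·t-comm v k _)

CutInversion-≤B : {u w : Word n} {p : Fin n} → IsPerm u → u ≤B w → CutInversion u p → CutInversion w p
CutInversion-≤B u-perm ≤B-refl cut = cut
CutInversion-≤B u-perm (≤B-step i j _ v<vt u≤v) cut =
  CutInversion-·t _ i j (≤B-IsPerm u-perm u≤v) v<vt (CutInversion-≤B u-perm u≤v cut)

Least : (Fin n → Set) → Fin n → Set
Least P y = P y × (∀ z → z F.< y → ¬ P z)

Greatest : (Fin n → Set) → Fin n → Set
Greatest P y = P y × (∀ z → y F.< z → ¬ P z)

least-witness : {P : Fin n → Set} → Decidable P → ∀ {x} → P x → ∃ (Least P)
least-witness {suc n} P? {x} px with P? zero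
... | yes p0 = zero , p0 , λ _ ()
least-witness {suc n} P? {zero} p0 | no ¬p0 = ⊥-elim (¬p0 p0)
least-witness {suc n} P? {suc x} px | no ¬p0 with least-witness (P? ∘ suc) px
... | y , py , below = suc y , py , λ { zero _ → ¬p0 ; (suc z) (s≤s z<y) → below z z<y }

greatest-witness : {P : Fin n → Set} → Decidable P → ∀ {x} → P x → ∃ (Greatest P)
greatest-witness {suc n} P? {x} px with Fₚ.any? (P? ∘ suc)
... | yes (x' , px') with greatest-witness (P? ∘ suc) px'
...   | y , py , above = suc y , py , λ { (suc z) (s≤s y<z) → above z y<z }
greatest-witness {suc n} P? {zero} p0 | no none = zero , p0 , λ { (suc z) _ pz → none (z , pz) }
greatest-witness {suc n} P? {suc x} px | no none = ⊥-elim (none (x , px))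

minimising-witness : {P : Fin n → Set} → Decidable P → (f : Fin n → Fin n) → ∀ {x} → P x →
                     ∃ λ y → P y × (∀ z → P z → f y F.≤ f z)
minimising-witness {n} {P} P? f {x} px
  with least-witness (λ m → Fₚ.any? λ y → P? y ×-dec (f y F.≟ m)) (x , px , refl)
... | _ , (y , py , refl) , below = y , py , λ z pz → ℕₚ.≮⇒≥ λ fz<fy → below (f z) fz<fy (z , pz , refl)

·t-coatom : (w : Word n) {a b : Fin n} → IsPerm w → a F.< b → lookup w b F.< lookup w a → NothingBetween w a b →
         P w (inv w ∸ 1) (w ·t[ a , b ])
·t-coatom w {a} {b} w-perm a<b wb<wa empty =
  IsPerm-·t a b w-perm ,
  ≤B-·t w (Fₚ.<⇒≢ a<b) (subst (inv (w ·t[ a , b ]) <_) (sym inv≡1+) (ℕₚ.n<1+n _)) ,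
  sym (cong (_∸ 1) inv≡1+)
  where
  inv≡1+ : inv w ≡ suc (inv (w ·t[ a , b ]))
  inv≡1+ = inv-·t-nothingBetween w (IsPerm⇒injective w-perm) a<b wb<wa empty

·t-pair-injective : (w : Word n) {a k a′ k′ : Fin n} → Injective _≡_ _≡_ (lookup w) → a F.< k → a′ F.< k′ →
                    w ·t[ a , k ] ≡ w ·t[ a′ , k′ ] → a ≡ a′ × k ≡ k′
·t-pair-injective w {a} {k} {a′} {k′} w-inj a<k a′<k′ eq = by-cases (transpose-moved a′ k′ a-moved)
  where
  k≡ta : k ≡ transpose a′ k′ a
  k≡ta = w-inj (begin
    lookup w k                       ≡⟨ lookup-·t-i w a k ⟨
    lookup (w ·t[ a , k ]) a         ≡⟨ cong (λ x → lookup x a) eq ⟩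
    lookup (w ·t[ a′ , k′ ]) a       ≡⟨ lookup-·t w a′ k′ a ⟩
    lookup w (transpose a′ k′ a)     ∎)
    where open ≡-Reasoning
  a-moved : transpose a′ k′ a ≢ a
  a-moved ta≡a = Fₚ.<⇒≢ a<k (sym (trans k≡ta ta≡a))
  by-cases : a ≡ a′ ⊎ a ≡ k′ → a ≡ a′ × k ≡ k′
  by-cases (inj₁ refl) = refl , trans k≡ta (transpose-i a k′)
  by-cases (inj₂ refl) = ⊥-elim (Fₚ.<-asym a<k (subst (F._< a) (sym (trans k≡ta (transpose-j a′ a))) a′<k′))

-- From atoms to coatoms

module _ {n} (w : Word n) (w-perm : IsPerm w) where

  private
    v : Fin n → Fin n
    v = lookup w
    w-inj : Injective _≡_ _≡_ v
    w-inj = IsPerm⇒injective w-perm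

  DropsAfter : Fin n → Fin n → Set
  DropsAfter p k = p F.< k × ∃ λ c → c F.≤ p × v k F.< v c

  ExceedsUpTo : Fin n → Fin n → Fin n → Set
  ExceedsUpTo p k a = a F.≤ p × v k F.< v a

  CutPair : Fin n → Fin n → Fin n → Set
  CutPair p a k = Least (DropsAfter p) k × Greatest (ExceedsUpTo p k) a

  dropsAfter? : ∀ p → Decidable (DropsAfter p)
  dropsAfter? p k = (p <? k) ×-dec Fₚ.any? λ c → (c Fₚ.≤? p) ×-dec (v k <? v c)

  exceedsUpTo? : ∀ p k → Decidable (ExceedsUpTo p k)
  exceedsUpTo? p k a = (a Fₚ.≤? p) ×-dec (v k <? v a)

  cutPair : ∀ {p} → CutInversion w p → ∃₂ λ a k → CutPair p a k
  cutPair {p} (c₀ , k₀ , c₀≤p , p<k₀ , vk₀<vc₀)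
    with least-witness (dropsAfter? p) (p<k₀ , c₀ , c₀≤p , vk₀<vc₀)
  ... | k , first@((_ , c , c≤p , vk<vc) , _) with greatest-witness (exceedsUpTo? p k) (c≤p , vk<vc)
  ...   | a , last = a , k , first , last

  CutPair⇒nothingBetween : ∀ {p a k} → CutPair p a k → a F.< k × NothingBetween w a k
  CutPair⇒nothingBetween {p} {a} {k} (((p<k , _) , first) , ((a≤p , _) , last)) =
    ℕₚ.≤-<-trans a≤p p<k , between
    where
    between : NothingBetween w a k
    between c a<c c<k (vk<vc , vc<va) with c Fₚ.≤? p
    ... | yes c≤p = last c a<c (c≤p , vk<vc)
    ... | no c≰p = first c c<k (ℕₚ.≰⇒> c≰p , a , a≤p , vc<va)

  CutCoatom : Fin n → Word n → Set
  CutCoatom p y = ∃₂ λ a k → CutPair p a k × y ≡ w ·t[ a , k ]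

  -- For q = p + 1 ≤ p′ the two cuts force w(a) ≤ w(q) ≤ w(k) < w(a).
  CutPair-adjacent-≮ : ∀ {p q p′ a k} → Adjacent p q → CutPair p a k → CutPair p′ a k → ¬ p F.< p′
  CutPair-adjacent-≮ {p} {q} {p′} {a} {k} adj ((_ , first) , ((a≤p , vk<va) , _)) (((p′<k , _) , _) , (_ , last′)) p<p′ =
    ℕₚ.<⇒≱ vk<va (ℕₚ.≤-trans va≤vq vq≤vk)
    where
    q≤p′ : q F.≤ p′
    q≤p′ = subst (_≤ toℕ p′) (sym adj) p<p′
    va≤vq : v a F.≤ v q
    va≤vq = ℕₚ.≮⇒≥ λ vq<va → first q (ℕₚ.≤-<-trans q≤p′ p′<k) (Adjacent⇒< adj , a , a≤p , vq<va)
    vq≤vk : v q F.≤ v k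
    vq≤vk = ℕₚ.≮⇒≥ λ vk<vq → last′ q (ℕₚ.≤-<-trans a≤p (Adjacent⇒< adj)) (q≤p′ , vk<vq)

  CutCoatom-adjacent-injective : ∀ {p q p′ q′ y} → Adjacent p q → Adjacent p′ q′ →
                                 CutCoatom p y → CutCoatom p′ y → p ≡ p′
  CutCoatom-adjacent-injective adj adj′ (a , k , pair , refl) (a′ , k′ , pair′ , eq)
    with ·t-pair-injective w w-inj (proj₁ (CutPair⇒nothingBetween pair)) (proj₁ (CutPair⇒nothingBetween pair′)) eq
  ... | refl , refl with Fₚ.<-cmp _ _
  ...   | tri< p<p′ _ _ = ⊥-elim (CutPair-adjacent-≮ adj pair pair′ p<p′)
  ...   | tri≈ _ p≡p′ _ = p≡p′
  ...   | tri> _ _ p′<p = ⊥-elim (CutPair-adjacent-≮ adj′ pair′ pair p′<p)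

  AtomToCoatom : Word n → Word n → Set
  AtomToCoatom u y = ∃₂ λ p q → Adjacent p q × u ≡ tabulate id ·t[ p , q ] × CutCoatom p y

  AtomToCoatom-injective : ∀ {u u′ y} → AtomToCoatom u y → AtomToCoatom u′ y → u ≡ u′
  AtomToCoatom-injective (p , q , adj , refl , cc) (p′ , q′ , adj′ , refl , cc′)
    with CutCoatom-adjacent-injective adj adj′ cc cc′
  ... | refl = cong (tabulate id ·t[ p ,_]) (Fₚ.toℕ-injective (trans adj (sym adj′)))

  atom↦coatom : ∀ {u} → P w 1 u → ∃ λ y → P w (inv w ∸ 1) y × AtomToCoatom u y
  atom↦coatom {u} (u-perm , u≤w , inv≡1) with inv≡1⇒adjacentTransposition u u-perm inv≡1
  ... | p , q , adj , desc , u≡ with cutPair (CutInversion-≤B u-perm u≤w (p , q , ℕₚ.≤-refl , Adjacent⇒< adj , desc))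
  ...   | a , k , pair@(_ , ((_ , vk<va) , _)) with a<k , empty ← CutPair⇒nothingBetween pair =
    w ·t[ a , k ] , ·t-coatom w w-perm a<k vk<va empty , p , q , adj , u≡ , a , k , pair , refl

  Occurrence4231 : Fin n → Fin n → Fin n → Fin n → Set
  Occurrence4231 p q r s = p F.< q × q F.< r × r F.< s × v r F.< v p × v q F.< v r × v s F.< v q

  FarCover : Fin n → Fin n → Fin n → Fin n → Set
  FarCover p r x s = p F.≤ x × x F.< r × r F.< s × v s F.< v r × v s F.< v x × NothingBetween w x s

  -- Among the positions in [p , s) with value above w(s) take x of least value: either x < r, or
  -- (p , q , r , x) is again an occurrence of 4231, ending earlier.
  farCover : ∀ fuel {p q r s} → toℕ s < fuel → Occurrence4231 p q r s → ∃₂ (FarCover p r)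
  farCover (suc fuel) {p} {q} {r} {s} s<fuel (p<q , q<r , r<s , vr<vp , vq<vr , vs<vq)
    with minimising-witness above? v {q} (ℕₚ.<⇒≤ p<q , Fₚ.<-trans q<r r<s , vs<vq)
    where
    above? : Decidable λ c → p F.≤ c × c F.< s × v s F.< v c
    above? c = (p Fₚ.≤? c) ×-dec (c <? s) ×-dec (v s <? v c)
  ... | x , (p≤x , x<s , vs<vx) , lowest with x <? r
  ...   | yes x<r = x , s , p≤x , x<r , r<s , Fₚ.<-trans vs<vq vq<vr , vs<vx , nothing-between
    where
    nothing-between : NothingBetween w x s
    nothing-between c x<c c<s (vs<vc , vc<vx) =
      ℕₚ.<⇒≱ vc<vx (lowest c (ℕₚ.≤-trans p≤x (ℕₚ.<⇒≤ x<c) , c<s , vs<vc))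
  ...   | no x≮r = farCover fuel (ℕₚ.<-≤-trans x<s (ℕₚ.≤-pred s<fuel)) (p<q , q<r , r<x , vr<vp , vq<vr , vx<vq)
    where
    vx≤vq : v x F.≤ v q
    vx≤vq = lowest q (ℕₚ.<⇒≤ p<q , Fₚ.<-trans q<r r<s , vs<vq)
    r<x : r F.< x
    r<x = Fₚ.≤∧≢⇒< (ℕₚ.≮⇒≥ x≮r) λ { refl → ℕₚ.<⇒≱ vq<vr vx≤vq }
    vx<vq : v x F.< v q
    vx<vq = Fₚ.≤∧≢⇒< vx≤vq (Fₚ.<⇒≢ (Fₚ.<-trans q<r r<x) ∘ sym ∘ w-inj)

  FarCover-unreachable : ∀ {p r x s} → v r F.< v p → FarCover p r x s → ∀ p′ → ¬ CutCoatom p′ (w ·t[ x , s ])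
  FarCover-unreachable {p} {r} vr<vp (p≤x , x<r , r<s , vs<vr , _) p′ (a , k , pair , eq)
    with ·t-pair-injective w w-inj (Fₚ.<-trans x<r r<s) (proj₁ (CutPair⇒nothingBetween pair)) eq
  ... | refl , refl with pair
  ...   | (_ , first) , ((x≤p′ , _) , last) with p′ <? p | p′ <? r
  ...     | yes p′<p | _ = ℕₚ.<-irrefl refl (ℕₚ.≤-<-trans x≤p′ (ℕₚ.<-≤-trans p′<p p≤x))
  ...     | no p′≮p | yes p′<r = first r r<s (p′<r , p , ℕₚ.≮⇒≥ p′≮p , vr<vp)
  ...     | no _ | no p′≮r = last r x<r (ℕₚ.≮⇒≥ p′≮r , vs<vr)

  contains4231⇒occurrence : (c : Contains w p4231) →
    let f = proj₁ c in Occurrence4231 (f 0F) (f 1F) (f 2F) (f 3F)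
  contains4231⇒occurrence (f , f-inc , f-order) =
    f-inc 0F 1F (s≤s z≤n) , f-inc 1F 2F (s≤s (s≤s z≤n)) , f-inc 2F 3F (s≤s (s≤s (s≤s z≤n))) ,
    Equivalence.from (f-order 2F 0F) (s≤s (s≤s (s≤s z≤n))) ,
    Equivalence.from (f-order 1F 2F) (s≤s (s≤s z≤n)) ,
    Equivalence.from (f-order 3F 1F) (s≤s z≤n)

  contains4231⇒unreachableCoatom : Contains w p4231 → ∃ λ y → P w (inv w ∸ 1) y × ∀ u → ¬ AtomToCoatom u y
  contains4231⇒unreachableCoatom c@(f , _) with contains4231⇒occurrence c
  ... | occurrence@(_ , _ , _ , vr<vp , _) with farCover (suc (toℕ (f 3F))) ℕₚ.≤-refl occurrence
  ...   | x , s , cover@(_ , x<r , r<s , _ , vs<vx , empty) =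
    w ·t[ x , s ] , ·t-coatom w w-perm (Fₚ.<-trans x<r r<s) vs<vx empty ,
    λ u (p , _ , _ , _ , reached) → FarCover-unreachable vr<vp cover p reached

-- Counting

∈-remove : ∀ {A : Set} {y : A} {ys : List A} → y ∈ ys →
           ∃ λ zs → length ys ≡ suc (length zs) × (∀ {z} → z ∈ ys → z ≢ y → z ∈ zs)
∈-remove y∈ys with l , r , refl ← ∈ₚ.∈-∃++ y∈ys =
  l List.++ r , trans (Listₚ.length-++ l) (trans (ℕₚ.+-suc _ _) (sym (cong suc (Listₚ.length-++ l)))) , keep
  where
  keep : ∀ {z} → z ∈ l List.++ _ List.∷ r → z ≢ _ → z ∈ l List.++ r
  keep z∈ z≢y with ∈ₚ.∈-++⁻ l z∈
  ... | inj₁ z∈l = ∈ₚ.∈-++⁺ˡ z∈l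
  ... | inj₂ (here z≡y) = ⊥-elim (z≢y z≡y)
  ... | inj₂ (there z∈r) = ∈ₚ.∈-++⁺ʳ l z∈r

module _ {A B : Set} (R : A → B → Set) (R-injective : ∀ {x x′ y} → R x y → R x′ y → x ≡ x′) where

  injection-length-≤ : ∀ {xs ys} → Unique xs → (∀ {x} → x ∈ xs → ∃ λ y → y ∈ ys × R x y) →
                       length xs ≤ length ys

  injection-length-< : ∀ {xs ys y₀} → Unique xs → (∀ {x} → x ∈ xs → ∃ λ y → y ∈ ys × R x y) →
                       y₀ ∈ ys → (∀ {x} → x ∈ xs → ¬ R x y₀) → length xs < length ys

  injection-length-≤ {[]} _ _ = z≤n
  injection-length-≤ {x ∷ xs} (x∉xs ∷ xs-unique) image with _ , y∈ys , Rxy ← image (here refl) =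
    injection-length-< xs-unique (image ∘ there) y∈ys λ x′∈ Rx′y → All.lookup x∉xs x′∈ (R-injective Rxy Rx′y)

  injection-length-< {xs} xs-unique image y₀∈ys missed with zs , ys≡ , keep ← ∈-remove y₀∈ys =
    subst (suc (length xs) ≤_) (sym ys≡) (s≤s (injection-length-≤ xs-unique image′))
    where
    image′ : ∀ {x} → x ∈ xs → ∃ λ y → y ∈ zs × R x y
    image′ x∈ with y , y∈ys , Rxy ← image x∈ = y , keep y∈ys (λ { refl → missed x∈ Rxy }) , Rxy

allVecs : ∀ {A : Set} → List A → (k : ℕ) → List (Vec A k)
allVecs xs zero = Vec.[] ∷ []
allVecs xs (suc k) = List.cartesianProductWith Vec._∷_ xs (allVecs xs k)

∈-allVecs : ∀ {A : Set} {xs : List A} → (∀ x → x ∈ xs) → ∀ {k} (v : Vec A k) → v ∈ allVecs xs k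
∈-allVecs all∈ Vec.[] = here refl
∈-allVecs all∈ (x Vec.∷ v) = ∈ₚ.∈-cartesianProductWith⁺ Vec._∷_ (all∈ x) (∈-allVecs all∈ v)

module _ {n} {Q : Word n → Set} (Q? : Decidable Q) where

  listing : List (Word n)
  listing = List.deduplicate _≟W_ (List.filter Q? (allVecs (List.allFin n) n))

  listing-unique : Unique listing
  listing-unique = UniqueDecₚ.deduplicate-! _≟W_ _

  ∈-listing⁺ : ∀ {u} → Q u → u ∈ listing
  ∈-listing⁺ q = ∈ₚ.∈-deduplicate⁺ _≟W_ (∈ₚ.∈-filter⁺ Q? (∈-allVecs ∈ₚ.∈-allFin _) q)

  ∈-listing⁻ : ∀ {u} → u ∈ listing → Q u
  ∈-listing⁻ u∈ = proj₂ (∈ₚ.∈-filter⁻ Q? {xs = allVecs (List.allFin n) n} (∈ₚ.∈-deduplicate⁻ _≟W_ _ u∈))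

  listing-size : HasSize Q (length listing)
  listing-size = listing , listing-unique , (λ u → mk⇔ ∈-listing⁻ ∈-listing⁺) , refl

module Counting {n} {Q Q′ : Word n → Set} (Q? : Decidable Q) (Q′? : Decidable Q′)
         (R : Word n → Word n → Set) (R-injective : ∀ {u u′ y} → R u y → R u′ y → u ≡ u′)
         (R-total : ∀ {u} → Q u → ∃ λ y → Q′ y × R u y) where

  private
    image : ∀ {u} → u ∈ listing Q? → ∃ λ y → y ∈ listing Q′? × R u y
    image u∈ with y , q′ , Ruy ← R-total (∈-listing⁻ Q? u∈) = y , ∈-listing⁺ Q′? q′ , Ruy

  count-≤ : length (listing Q?) ≤ length (listing Q′?)
  count-≤ = injection-length-≤ R R-injective (listing-unique Q?) image

  count-< : (∃ λ y → Q′ y × ∀ u → ¬ R u y) → length (listing Q?) < length (listing Q′?)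
  count-< (y , q′ , missed) =
    injection-length-< R R-injective (listing-unique Q?) image (∈-listing⁺ Q′? q′) λ {u} _ → missed u

P? : (w : Word n) (k : ℕ) → Decidable (P w k)
P? w k u = UniqueDec.unique? F._≟_ (toList u) ×-dec u ≤B? w ×-dec inv u ℕ.≟ k

lemma3p4 : (n : ℕ) (w : Word n) → IsPerm w →
    ∃₂ λ a b → HasSize (P w (inv w ∸ 1)) a × HasSize (P w 1) b ×
      b ≤ a × (Contains w p4231 → b < a)
lemma3p4 n w w-perm =
  _ , _ , listing-size coatom? , listing-size atom? , count-≤ , count-< ∘ contains4231⇒unreachableCoatom w w-perm
  where
  atom? : Decidable (P w 1)
  atom? = P? w 1
  coatom? : Decidable (P w (inv w ∸ 1))
  coatom? = P? w (inv w ∸ 1)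
  open Counting atom? coatom? (AtomToCoatom w w-perm) (AtomToCoatom-injective w w-perm) (atom↦coatom w w-perm)
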